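{- Let $n\geqslant 3$ and integers $a_2,\dots,a_n$ be given, and assume that $H(a_2,a_3,\dots,a_n;q,t)$ is a polynomial in $q,t$ with nonnegative coefficients. Then for all sufficiently large integers $N$, the function $F(N,a_3,\dots,a_n)$ is a polynomial with nonnegative coefficients.
   Context: Let $q,t$ be indeterminates. A standard Young tableau $T$ with $n$ boxes is a bijective filling of the Young diagram of a partition of $n$ by $1,\dots,n$, increasing along rows (left to right) and columns (bottom to top); rows $r$ counted from the bottom, columns $c$ from the left, starting at $1$. Let $z_i=z_i(T)=q^{c-1}t^{r-1}$ where $i$ sits in row $r$, column $c$. Define \[\mathrm{wt}(T)=\prod_{i=2}^{n}\frac{1}{(1-z_i^{ -1})(1-qtz_{i-1}/z_i)}\prod_{1\leqslant i<j\leqslant n}\frac{(1-z_i/z_j)(1-qtz_i/z_j)}{(1-qz_i/z_j)(1-tz_i/z_j)},\] omitting any individual factor that vanishes, and $F(a_2,\dots,a_n)=\sum_T z_2^{a_2}\cdots z_n^{a_n}\mathrm{wt}(T)$ over all standard Young tableaux with $n$ boxes. Define $H(a_2,\dots,a_n;q,t)=\sum_{T:\ z_2(T)=q}z_2^{a_2}\cdots z_n^{a_n}(1-t/q)\mathrm{wt}(T)$, summing over standard Young tableaux with $n$ boxes in which $2$ lies in row 1, column 2. -}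

module Defs where

open import Data.Bool using (Bool; true; false; _∧_; _∨_; not; if_then_else_)
open import Data.Nat as ℕ using (ℕ; zero; suc; _≡ᵇ_; _<ᵇ_)
open import Data.Integer as ℤ using (ℤ; +_; -_)
open import Data.List using (List; []; _∷_; _++_; map; concatMap; foldr; upTo; zip; zipWith; drop; filterᵇ; length)
open import Data.Bool.ListAction using (all; any)
open import Data.Vec using (Vec; toList)
import Data.Vec as Vec
open import Data.Product using (_×_; _,_; proj₁; proj₂; Σ)
open import Relation.Nullary.Decidable using (⌊_⌋)
open import Relation.Binary.PropositionalEquality using (_≡_)

-- A term (c , (i , j)) stands for c · q^i t^j; a polynomial is a finite
-- formal sum of terms (repetitions allowed, compared via coefficients).

Exp : Set
Exp = ℤ × ℤ

LPoly : Set
LPoly = List (ℤ × Exp)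

_+ᵉ_ : Exp → Exp → Exp
(a , b) +ᵉ (c , d) = (a ℤ.+ c , b ℤ.+ d)

-ᵉ_ : Exp → Exp
-ᵉ (a , b) = (- a , - b)

_·ᵉ_ : ℤ → Exp → Exp
k ·ᵉ (a , b) = (k ℤ.* a , k ℤ.* b)

zeroᵉ : Exp
zeroᵉ = (+ 0 , + 0)

coeff : LPoly → ℤ → ℤ → ℤ
coeff p i j = foldr (λ m acc → if ⌊ proj₁ (proj₂ m) ℤ.≟ i ⌋ ∧ ⌊ proj₂ (proj₂ m) ℤ.≟ j ⌋
                                then proj₁ m ℤ.+ acc else acc) (+ 0) p

_≈ᴾ_ : LPoly → LPoly → Set
p ≈ᴾ p' = (i j : ℤ) → coeff p i j ≡ coeff p' i j

_*ᴾ_ : LPoly → LPoly → LPoly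
p *ᴾ p' = concatMap (λ m → map (λ m' → (proj₁ m ℤ.* proj₁ m' , proj₂ m +ᵉ proj₂ m')) p') p

oneᴾ : LPoly
oneᴾ = (+ 1 , zeroᵉ) ∷ []

monoᴾ : Exp → LPoly
monoᴾ e = (+ 1 , e) ∷ []

record RatFun : Set where
  constructor _/_
  field
    num : LPoly
    den : LPoly
open RatFun public

_≈ᴿ_ : RatFun → RatFun → Set
x ≈ᴿ y = (num x *ᴾ den y) ≈ᴾ (num y *ᴾ den x)

_+ᴿ_ : RatFun → RatFun → RatFun
x +ᴿ y = ((num x *ᴾ den y) ++ (num y *ᴾ den x)) / (den x *ᴾ den y)

_*ᴿ_ : RatFun → RatFun → RatFun
x *ᴿ y = (num x *ᴾ num y) / (den x *ᴾ den y)

zeroᴿ : RatFun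
zeroᴿ = [] / oneᴾ

oneᴿ : RatFun
oneᴿ = oneᴾ / oneᴾ

sumᴿ : List RatFun → RatFun
sumᴿ = foldr _+ᴿ_ zeroᴿ

prodᴿ : List RatFun → RatFun
prodᴿ = foldr _*ᴿ_ oneᴿ

isZeroExp : Exp → Bool
isZeroExp (+ zero , + zero) = true
isZeroExp _ = false

-- the polynomial 1 - q^i t^j, replaced by 1 when it vanishes (i = j = 0)
oneMinus : Exp → LPoly
oneMinus e = if isZeroExp e then oneᴾ else ((+ 1 , zeroᵉ) ∷ (- (+ 1) , e) ∷ [])

numF : Exp → RatFun
numF e = oneMinus e / oneᴾ

denF : Exp → RatFun
denF e = oneᴾ / oneMinus e

IsNNPoly : RatFun → Set
IsNNPoly x = Σ (List (ℕ × (ℕ × ℕ))) λ P →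
  x ≈ᴿ (map (λ m → (+ proj₁ m , (+ proj₁ (proj₂ m) , + proj₂ (proj₂ m)))) P / oneᴾ)

-- Standard Young tableaux with n boxes.
-- A filling is encoded as the list of cells of the entries 1,2,…,n in
-- order; a cell is (r - 1 , c - 1) (0-based row from bottom, column from left).

Cell : Set
Cell = ℕ × ℕ

cellEq : Cell → Cell → Bool
cellEq (r , c) (r' , c') = (r ≡ᵇ r') ∧ (c ≡ᵇ c')

allFillings : ℕ → ℕ → List (List Cell)
allFillings zero b = [] ∷ []
allFillings (suc k) b =
  concatMap (λ r → concatMap (λ c → map ((r , c) ∷_) (allFillings k b)) (upTo b)) (upTo b)

pairs : {A : Set} → List A → List (A × A)
pairs [] = []
pairs (x ∷ xs) = map (x ,_) xs ++ pairs xs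

_∈ᶜ_ : Cell → List Cell → Bool
x ∈ᶜ T = any (cellEq x) T

-- the filling is a bijection onto a Young diagram (French convention)
-- with entries increasing along rows and up columns
isSYT : List Cell → Bool
isSYT T =
  all (λ p → not (cellEq (proj₁ p) (proj₂ p))) (pairs T)
  ∧ all (λ x → ((proj₁ x ≡ᵇ 0) ∨ ((ℕ.pred (proj₁ x) , proj₂ x) ∈ᶜ T))
             ∧ ((proj₂ x ≡ᵇ 0) ∨ ((proj₁ x , ℕ.pred (proj₂ x)) ∈ᶜ T))) T
  ∧ all (λ p → not ((proj₁ (proj₁ p) ≡ᵇ proj₁ (proj₂ p)) ∧ (proj₂ (proj₂ p) <ᵇ proj₂ (proj₁ p)))
             ∧ not ((proj₂ (proj₁ p) ≡ᵇ proj₂ (proj₂ p)) ∧ (proj₁ (proj₂ p) <ᵇ proj₁ (proj₁ p))))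
        (pairs T)

-- all standard Young tableaux with n boxes (every such tableau fits in an n × n box)
SYT : ℕ → List (List Cell)
SYT n = filterᵇ isSYT (allFillings n n)

-- z_i = q^(c-1) t^(r-1), as an exponent pair (c - 1 , r - 1)
zExp : Cell → Exp
zExp (r , c) = (+ c , + r)

qtᵉ qᵉ tᵉ : Exp
qtᵉ = (+ 1 , + 1)
qᵉ = (+ 1 , + 0)
tᵉ = (+ 0 , + 1)

wt : List Cell → RatFun
wt T =
  prodᴿ (zipWith (λ zprev z → denF (-ᵉ z) *ᴿ denF (qtᵉ +ᵉ (zprev +ᵉ (-ᵉ z)))) zs (drop 1 zs))
  *ᴿ prodᴿ (map (λ p → let d = proj₁ p +ᵉ (-ᵉ proj₂ p) in
                 numF d *ᴿ (numF (qtᵉ +ᵉ d) *ᴿ (denF (qᵉ +ᵉ d) *ᴿ denF (tᵉ +ᵉ d))))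
                (pairs zs))
  where zs = map zExp T

-- z_2^{a_2} ⋯ z_n^{a_n}, with a = (a_2 , … , a_n)
zPow : List ℤ → List Cell → RatFun
zPow a T = monoᴾ (foldr _+ᵉ_ zeroᵉ (zipWith _·ᵉ_ a (drop 1 (map zExp T)))) / oneᴾ

F : (n : ℕ) → Vec ℤ (n ℕ.∸ 1) → RatFun
F n a = sumᴿ (map (λ T → zPow (toList a) T *ᴿ wt T) (SYT n))

-- tableaux in which 2 lies in row 1, column 2
twoAt12 : List Cell → Bool
twoAt12 (_ ∷ x ∷ _) = cellEq x (0 , 1)
twoAt12 _ = false

H : (n : ℕ) → Vec ℤ (n ℕ.∸ 1) → RatFun
H n a = sumᴿ (map (λ T → zPow (toList a) T *ᴿ (numF ((-ᵉ qᵉ) +ᵉ tᵉ) *ᴿ wt T))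
                  (filterᵇ twoAt12 (SYT n)))

setFirst : {k : ℕ} → ℤ → Vec ℤ k → Vec ℤ k
setFirst N Vec.[] = Vec.[]
setFirst N (_ Vec.∷ xs) = N Vec.∷ xs

module Submission where

-- The cell of 2 in a standard Young tableau is (1,2) or (2,1), and transposition exchanges
-- the two classes while replacing every z_i by its image under the swap σ : q ↔ t; since wt is
-- σ-equivariant, F = F₁₂ + σ F₁₂ with F₁₂ the sum over tableaux with z₂ = q.  On those
-- tableaux raising a₂ to N = a₂ + k multiplies each summand by q^k, so (1 - t/q) F₁₂ = q^k P
-- where P = H has nonnegative coefficients.  As σ(1 - t/q) = -(q/t)(1 - t/q), this gives
-- (1 - t/q) F = q^k P(q,t) - (t^(k+1)/q) P(t,q), and the monomial c q^i t^j of P contributes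
-- c (q^(k+i) t^j - q^(j-1) t^(k+i+1)), whose quotient by 1 - t/q is a sum of nonnegative
-- monomials once k ≥ j.  Multiplication by 1 - t/q is injective on Laurent polynomials, so F is
-- that quotient as soon as N ≥ a₂ + deg_t P.

open import Defs
open import Algebra.Bundles using (CommutativeRing)
import Algebra.Solver.Ring
open import Algebra.Solver.Ring.AlmostCommutativeRing using (fromCommutativeRing; _-Raw-AlmostCommutative⟶_)
open import Data.Bool using (Bool; true; false; T; _∧_; _∨_; not)
open import Data.Bool.ListAction using (all; and; or)
open import Data.Bool.Properties using (T?; T-∧; ∧-comm)
open import Data.Integer using (ℤ; +_; -_; -[1+_]; _+_; _*_; _-_; +≤+)
import Data.Integer as ℤ
import Data.Integer.Properties as ℤP
open import Data.Integer.Tactic.RingSolver using (solve-∀)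
open import Data.List using (List; []; _∷_; _++_; map; concatMap; upTo; filterᵇ; length; zipWith; drop; foldr)
import Data.List.Properties as LP
open import Data.List.Membership.Propositional using (_∈_)
open import Data.List.Relation.Binary.Permutation.Propositional
  using (_↭_; ↭-refl; ↭-sym; ↭-trans; ↭-reflexive; prep; module PermutationReasoning)
import Data.List.Relation.Binary.Permutation.Propositional as ↭
open import Data.List.Relation.Binary.Permutation.Propositional.Properties
  using (map⁺; ++⁺; ++⁺ˡ; shifts; shift; filter-↭)
open import Data.List.Relation.Unary.All as All using (All; []; _∷_)
import Data.List.Relation.Unary.All.Properties as AllP
import Data.List.Relation.Unary.Any as Any
open import Data.List.Relation.Unary.Any.Properties using (any⁻)
open import Data.Maybe using (just; nothing)
open import Data.Nat as ℕ using (ℕ; zero; suc; _≤_; _∸_; _⊔_; s≤s; z≤n; _≡ᵇ_; _<ᵇ_)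
import Data.Nat.Properties as ℕP
open import Data.Product using (Σ; _×_; _,_; proj₁; proj₂)
open import Data.Sum using (_⊎_; inj₁; inj₂)
open import Data.Vec using (Vec; toList) renaming (_∷_ to _∷ᵛ_)
open import Function using (_∘_; Equivalence)
open import Relation.Binary.Definitions using (WeaklyDecidable)
open import Relation.Binary.PropositionalEquality as ≡ using (_≡_; cong; cong₂)
import Relation.Binary.Reasoning.Setoid
open import Relation.Nullary using (¬_; contradiction)
open import Relation.Nullary.Decidable using (⌊_⌋; yes; no)

-- Laurent polynomials as a commutative ring

Coeffs : Set
Coeffs = ℤ → ℤ → ℤ

infix 4 _≐_
_≐_ : Coeffs → Coeffs → Set
f ≐ g = ∀ i j → f i j ≡ g i j

-- p ⊛ f is the coefficient function of p times the formal series with coefficients f.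
infixr 7 _⊛_
_⊛_ : LPoly → Coeffs → Coeffs
([] ⊛ f) i j = + 0
(((c , (a , b)) ∷ p) ⊛ f) i j = c * f (i - a) (j - b) + (p ⊛ f) i j

δ : Coeffs
δ = coeff oneᴾ

≟-shift : ∀ a i → ⌊ a ℤ.≟ i ⌋ ≡ ⌊ + 0 ℤ.≟ i - a ⌋
≟-shift a i with a ℤ.≟ i | + 0 ℤ.≟ i - a
... | yes _      | yes _ = ≡.refl
... | no _       | no _  = ≡.refl
... | yes ≡.refl | no ne = contradiction (≡.sym (ℤP.+-inverseʳ a)) ne
... | no ne      | yes e = contradiction (≡.sym (ℤP.i-j≡0⇒i≡j i a (≡.sym e))) ne

coeff-∷ : ∀ c a b p i j → coeff ((c , (a , b)) ∷ p) i j ≡ c * δ (i - a) (j - b) + coeff p i j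
coeff-∷ c a b p i j rewrite ≟-shift a i | ≟-shift b j with ⌊ + 0 ℤ.≟ i - a ⌋ ∧ ⌊ + 0 ℤ.≟ j - b ⌋
... | true  = cong (_+ coeff p i j) (≡.sym (ℤP.*-identityʳ c))
... | false = ≡.sym (≡.trans (cong (_+ coeff p i j) (ℤP.*-zeroʳ c)) (ℤP.+-identityˡ (coeff p i j)))

coeff≐⊛δ : ∀ p → coeff p ≐ p ⊛ δ
coeff≐⊛δ [] i j = ≡.refl
coeff≐⊛δ ((c , (a , b)) ∷ p) i j =
  ≡.trans (coeff-∷ c a b p i j) (cong (_+_ (c * δ (i - a) (j - b))) (coeff≐⊛δ p i j))

i-b-a≡i-a-b : ∀ i a b → i - b - a ≡ i - a - b
i-b-a≡i-a-b = solve-∀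

i-[a+b]≡i-a-b : ∀ i a b → i - (a + b) ≡ i - a - b
i-[a+b]≡i-a-b = solve-∀

⊛-cong : ∀ p {f g} → f ≐ g → p ⊛ f ≐ p ⊛ g
⊛-cong [] e i j = ≡.refl
⊛-cong ((c , (a , b)) ∷ p) e i j = cong₂ (λ x y → c * x + y) (e (i - a) (j - b)) (⊛-cong p e i j)

⊛-zero : ∀ p → p ⊛ (λ _ _ → + 0) ≐ (λ _ _ → + 0)
⊛-zero [] i j = ≡.refl
⊛-zero ((c , (a , b)) ∷ p) i j rewrite ⊛-zero p i j | ℤP.*-zeroʳ c = ≡.refl

⊛-+ : ∀ p f g → p ⊛ (λ x y → f x y + g x y) ≐ (λ i j → (p ⊛ f) i j + (p ⊛ g) i j)
⊛-+ [] f g i j = ≡.refl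
⊛-+ ((c , (a , b)) ∷ p) f g i j rewrite ⊛-+ p f g i j =
  distrib c (f (i - a) (j - b)) (g (i - a) (j - b)) ((p ⊛ f) i j) ((p ⊛ g) i j)
  where distrib : ∀ c x y u v → c * (x + y) + (u + v) ≡ c * x + u + (c * y + v)
        distrib = solve-∀

⊛-scale : ∀ p k f → p ⊛ (λ x y → k * f x y) ≐ (λ i j → k * (p ⊛ f) i j)
⊛-scale [] k f i j = ≡.sym (ℤP.*-zeroʳ k)
⊛-scale ((c , (a , b)) ∷ p) k f i j rewrite ⊛-scale p k f i j =
  swap-scale c k (f (i - a) (j - b)) ((p ⊛ f) i j)
  where swap-scale : ∀ c k x u → c * (k * x) + k * u ≡ k * (c * x + u)
        swap-scale = solve-∀

⊛-shift : ∀ p a b f → p ⊛ (λ x y → f (x - a) (y - b)) ≐ (λ i j → (p ⊛ f) (i - a) (j - b))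
⊛-shift [] a b f i j = ≡.refl
⊛-shift ((c , (a′ , b′)) ∷ p) a b f i j
  rewrite ⊛-shift p a b f i j | i-b-a≡i-a-b i a a′ | i-b-a≡i-a-b j b b′ = ≡.refl

⊛-++ : ∀ p r f → (p ++ r) ⊛ f ≐ (λ i j → (p ⊛ f) i j + (r ⊛ f) i j)
⊛-++ [] r f i j = ≡.sym (ℤP.+-identityˡ _)
⊛-++ ((c , (a , b)) ∷ p) r f i j rewrite ⊛-++ p r f i j =
  ≡.sym (ℤP.+-assoc (c * f (i - a) (j - b)) ((p ⊛ f) i j) ((r ⊛ f) i j))

⊛-monomial : ∀ c a b r f → map (λ m → (c * proj₁ m , (a , b) +ᵉ proj₂ m)) r ⊛ f
                          ≐ (λ i j → c * (r ⊛ f) (i - a) (j - b))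
⊛-monomial c a b [] f i j = ≡.sym (ℤP.*-zeroʳ c)
⊛-monomial c a b ((c′ , (a′ , b′)) ∷ r) f i j
  rewrite ⊛-monomial c a b r f i j | i-[a+b]≡i-a-b i a a′ | i-[a+b]≡i-a-b j b b′ =
  factor c c′ (f (i - a - a′) (j - b - b′)) ((r ⊛ f) (i - a) (j - b))
  where factor : ∀ c c′ x u → c * c′ * x + c * u ≡ c * (c′ * x + u)
        factor = solve-∀

⊛-*ᴾ : ∀ p r f → (p *ᴾ r) ⊛ f ≐ p ⊛ (r ⊛ f)
⊛-*ᴾ [] r f i j = ≡.refl
⊛-*ᴾ ((c , (a , b)) ∷ p) r f i j =
  ≡.trans (⊛-++ (map (λ m → (c * proj₁ m , (a , b) +ᵉ proj₂ m)) r) (p *ᴾ r) f i j)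
          (cong₂ _+_ (⊛-monomial c a b r f i j) (⊛-*ᴾ p r f i j))

⊛-comm : ∀ p r f → p ⊛ (r ⊛ f) ≐ r ⊛ (p ⊛ f)
⊛-comm [] r f i j = ≡.sym (⊛-zero r i j)
⊛-comm ((c , (a , b)) ∷ p) r f i j = ≡.sym (begin
  (r ⊛ (λ x y → c * f (x - a) (y - b) + (p ⊛ f) x y)) i j
    ≡⟨ ⊛-+ r (λ x y → c * f (x - a) (y - b)) (p ⊛ f) i j ⟩
  (r ⊛ (λ x y → c * f (x - a) (y - b))) i j + (r ⊛ (p ⊛ f)) i j
    ≡⟨ cong₂ _+_ (≡.trans (⊛-scale r c (λ x y → f (x - a) (y - b)) i j)
                        (cong (c *_) (⊛-shift r a b f i j)))
                 (≡.sym (⊛-comm p r f i j)) ⟩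
  c * (r ⊛ f) (i - a) (j - b) + (p ⊛ (r ⊛ f)) i j ∎)
  where open ≡.≡-Reasoning

coeff-*ᴾ : ∀ p r → coeff (p *ᴾ r) ≐ p ⊛ coeff r
coeff-*ᴾ p r i j = ≡.trans (coeff≐⊛δ (p *ᴾ r) i j)
  (≡.trans (⊛-*ᴾ p r δ i j) (⊛-cong p (λ x y → ≡.sym (coeff≐⊛δ r x y)) i j))

coeff-++ : ∀ p r → coeff (p ++ r) ≐ (λ i j → coeff p i j + coeff r i j)
coeff-++ p r i j = ≡.trans (coeff≐⊛δ (p ++ r) i j) (≡.trans (⊛-++ p r δ i j)
  (≡.sym (cong₂ _+_ (coeff≐⊛δ p i j) (coeff≐⊛δ r i j))))

-ᴾ_ : LPoly → LPoly
-ᴾ p = map (λ m → (- proj₁ m , proj₂ m)) p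

⊛-neg : ∀ p f → (-ᴾ p) ⊛ f ≐ (λ i j → - (p ⊛ f) i j)
⊛-neg [] f i j = ≡.refl
⊛-neg ((c , (a , b)) ∷ p) f i j rewrite ⊛-neg p f i j = neg-distrib c (f (i - a) (j - b)) ((p ⊛ f) i j)
  where neg-distrib : ∀ c x u → - c * x + - u ≡ - (c * x + u)
        neg-distrib = solve-∀

coeff-neg : ∀ p → coeff (-ᴾ p) ≐ (λ i j → - coeff p i j)
coeff-neg p i j = ≡.trans (coeff≐⊛δ (-ᴾ p) i j) (≡.trans (⊛-neg p δ i j) (cong -_ (≡.sym (coeff≐⊛δ p i j))))

-- Wrapping ≈ᴾ in a record makes both sides recoverable by unification.
infix 4 _≋_
record _≋_ (p r : LPoly) : Set where
  constructor ⟨_⟩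
  field get : p ≈ᴾ r
open _≋_

coeff-*ᴾ-⊛δ : ∀ p r → coeff (p *ᴾ r) ≐ p ⊛ r ⊛ δ
coeff-*ᴾ-⊛δ p r i j = ≡.trans (coeff≐⊛δ (p *ᴾ r) i j) (⊛-*ᴾ p r δ i j)

*ᴾ-comm : ∀ p r → (p *ᴾ r) ≈ᴾ (r *ᴾ p)
*ᴾ-comm p r i j = ≡.trans (coeff-*ᴾ-⊛δ p r i j) (≡.trans (⊛-comm p r δ i j) (≡.sym (coeff-*ᴾ-⊛δ r p i j)))

*ᴾ-assoc : ∀ p r s → ((p *ᴾ r) *ᴾ s) ≈ᴾ (p *ᴾ (r *ᴾ s))
*ᴾ-assoc p r s i j = ≡.trans (coeff-*ᴾ-⊛δ (p *ᴾ r) s i j) (≡.trans (⊛-*ᴾ p r (s ⊛ δ) i j)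
  (≡.sym (≡.trans (coeff-*ᴾ-⊛δ p (r *ᴾ s) i j) (⊛-cong p (⊛-*ᴾ r s δ) i j))))

*ᴾ-congˡ : ∀ p {r s} → r ≈ᴾ s → (p *ᴾ r) ≈ᴾ (p *ᴾ s)
*ᴾ-congˡ p {r} {s} e i j = ≡.trans (coeff-*ᴾ p r i j) (≡.trans (⊛-cong p e i j) (≡.sym (coeff-*ᴾ p s i j)))

*ᴾ-cong : ∀ {p p′ r r′} → p ≋ p′ → r ≋ r′ → (p *ᴾ r) ≈ᴾ (p′ *ᴾ r′)
*ᴾ-cong {p} {p′} {r} {r′} ⟨ e ⟩ ⟨ f ⟩ i j = ≡.trans (*ᴾ-congˡ p f i j)
  (≡.trans (*ᴾ-comm p r′ i j) (≡.trans (*ᴾ-congˡ r′ e i j) (*ᴾ-comm r′ p′ i j)))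

*ᴾ-identityˡ : ∀ p → (oneᴾ *ᴾ p) ≈ᴾ p
*ᴾ-identityˡ p i j = ≡.trans (coeff-*ᴾ oneᴾ p i j) (≡.trans (ℤP.+-identityʳ _)
  (≡.trans (ℤP.*-identityˡ _) (cong₂ (coeff p) (ℤP.+-identityʳ i) (ℤP.+-identityʳ j))))

*ᴾ-distribˡ : ∀ p r s → (p *ᴾ (r ++ s)) ≈ᴾ ((p *ᴾ r) ++ (p *ᴾ s))
*ᴾ-distribˡ p r s i j = ≡.trans (coeff-*ᴾ p (r ++ s) i j)
  (≡.trans (⊛-cong p (coeff-++ r s) i j) (≡.trans (⊛-+ p (coeff r) (coeff s) i j)
  (≡.sym (≡.trans (coeff-++ (p *ᴾ r) (p *ᴾ s) i j) (cong₂ _+_ (coeff-*ᴾ p r i j) (coeff-*ᴾ p s i j))))))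

++-cong : ∀ {p p′ r r′} → p ≋ p′ → r ≋ r′ → (p ++ r) ≈ᴾ (p′ ++ r′)
++-cong {p} {p′} {r} {r′} ⟨ e ⟩ ⟨ f ⟩ i j =
  ≡.trans (coeff-++ p r i j) (≡.trans (cong₂ _+_ (e i j) (f i j)) (≡.sym (coeff-++ p′ r′ i j)))

++-comm : ∀ p r → (p ++ r) ≈ᴾ (r ++ p)
++-comm p r i j = ≡.trans (coeff-++ p r i j) (≡.trans (ℤP.+-comm (coeff p i j) (coeff r i j)) (≡.sym (coeff-++ r p i j)))

-ᴾ-inverseˡ : ∀ p → ((-ᴾ p) ++ p) ≈ᴾ []
-ᴾ-inverseˡ p i j = ≡.trans (coeff-++ (-ᴾ p) p i j)
  (≡.trans (cong (_+ coeff p i j) (coeff-neg p i j)) (ℤP.+-inverseˡ (coeff p i j)))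

-ᴾ-cong : ∀ {p r} → p ≋ r → (-ᴾ p) ≈ᴾ (-ᴾ r)
-ᴾ-cong {p} {r} ⟨ e ⟩ i j = ≡.trans (coeff-neg p i j) (≡.trans (cong -_ (e i j)) (≡.sym (coeff-neg r i j)))

*ᴾ-distribʳ : ∀ p r s → ((r ++ s) *ᴾ p) ≈ᴾ ((r *ᴾ p) ++ (s *ᴾ p))
*ᴾ-distribʳ p r s i j = ≡.trans (*ᴾ-comm (r ++ s) p i j) (≡.trans (*ᴾ-distribˡ p r s i j)
  (++-cong {p *ᴾ r} {r *ᴾ p} {p *ᴾ s} {s *ᴾ p} ⟨ *ᴾ-comm p r ⟩ ⟨ *ᴾ-comm p s ⟩ i j))

LPoly-commutativeRing : CommutativeRing _ _
LPoly-commutativeRing = record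
  { Carrier = LPoly ; _≈_ = _≋_ ; _+_ = _++_ ; _*_ = _*ᴾ_ ; -_ = -ᴾ_ ; 0# = [] ; 1# = oneᴾ
  ; isCommutativeRing = record
    { isRing = record
      { +-isAbelianGroup = record
        { isGroup = record
          { isMonoid = record
            { isSemigroup = record
              { isMagma = record
                { isEquivalence = record
                  { refl = ⟨ (λ i j → ≡.refl) ⟩
                  ; sym = λ e → ⟨ (λ i j → ≡.sym (get e i j)) ⟩
                  ; trans = λ e f → ⟨ (λ i j → ≡.trans (get e i j) (get f i j)) ⟩ }
                ; ∙-cong = λ e f → ⟨ ++-cong e f ⟩ }
              ; assoc = λ p r s → ⟨ (λ i j → cong (λ x → coeff x i j) (LP.++-assoc p r s)) ⟩ }
            ; identity = (λ p → ⟨ (λ i j → ≡.refl) ⟩)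
                       , (λ p → ⟨ (λ i j → cong (λ x → coeff x i j) (LP.++-identityʳ p)) ⟩) }
          ; inverse = (λ p → ⟨ -ᴾ-inverseˡ p ⟩)
                    , (λ p → ⟨ (λ i j → ≡.trans (++-comm p (-ᴾ p) i j) (-ᴾ-inverseˡ p i j)) ⟩)
          ; ⁻¹-cong = λ e → ⟨ -ᴾ-cong e ⟩ }
        ; comm = λ p r → ⟨ ++-comm p r ⟩ }
      ; *-cong = λ e f → ⟨ *ᴾ-cong e f ⟩
      ; *-assoc = λ p r s → ⟨ *ᴾ-assoc p r s ⟩
      ; *-identity = (λ p → ⟨ *ᴾ-identityˡ p ⟩)
                   , (λ p → ⟨ (λ i j → ≡.trans (*ᴾ-comm p oneᴾ i j) (*ᴾ-identityˡ p i j)) ⟩)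
      ; distrib = (λ p r s → ⟨ *ᴾ-distribˡ p r s ⟩)
                , (λ p r s → ⟨ *ᴾ-distribʳ p r s ⟩) }
    ; *-comm = λ p r → ⟨ *ᴾ-comm p r ⟩ } }

module LR = CommutativeRing LPoly-commutativeRing

constᴾ : ℤ → LPoly
constᴾ k = (k , zeroᵉ) ∷ []

constᴾ-morphism : CommutativeRing.rawRing ℤP.+-*-commutativeRing
                    -Raw-AlmostCommutative⟶ fromCommutativeRing LPoly-commutativeRing
constᴾ-morphism = record
  { ⟦_⟧ = constᴾ
  ; +-homo = λ k l → ⟨ coeff-+ k l ⟩
  ; *-homo = λ k l → ⟨ (λ i j → ≡.refl) ⟩
  ; -‿homo = λ k → ⟨ (λ i j → ≡.refl) ⟩
  ; 0-homo = ⟨ coeff-0 ⟩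
  ; 1-homo = ⟨ (λ i j → ≡.refl) ⟩ }
  where
  coeff-+ : ∀ k l → constᴾ (k + l) ≈ᴾ (constᴾ k ++ constᴾ l)
  coeff-+ k l i j with + 0 ℤ.≟ i | + 0 ℤ.≟ j
  ... | yes _ | yes _ = ℤP.+-assoc k l (+ 0)
  ... | yes _ | no _  = ≡.refl
  ... | no _  | _     = ≡.refl
  coeff-0 : constᴾ (+ 0) ≈ᴾ []
  coeff-0 i j with + 0 ℤ.≟ i | + 0 ℤ.≟ j
  ... | yes _ | yes _ = ≡.refl
  ... | yes _ | no _  = ≡.refl
  ... | no _  | _     = ≡.refl

constᴾ-≟ : WeaklyDecidable (λ k l → constᴾ k ≋ constᴾ l)
constᴾ-≟ k l with k ℤ.≟ l
... | yes ≡.refl = just ⟨ (λ i j → ≡.refl) ⟩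
... | no _     = nothing

open Algebra.Solver.Ring _ _ constᴾ-morphism constᴾ-≟ using (solve; _:+_; _:*_; :-_; _:-_; _:=_)
module ≋-Reasoning = Relation.Binary.Reasoning.Setoid LR.setoid

-- Equality of numerators and of denominators; unlike ≈ᴿ it is obviously a congruence.
infix 4 _≅_
_≅_ : RatFun → RatFun → Set
x ≅ y = (num x ≋ num y) × (den x ≋ den y)

≅-refl : ∀ {x} → x ≅ x
≅-refl = LR.refl , LR.refl

≅-reflexive : ∀ {x y} → x ≡ y → x ≅ y
≅-reflexive ≡.refl = ≅-refl

≅-sym : ∀ {x y} → x ≅ y → y ≅ x
≅-sym (n , d) = LR.sym n , LR.sym d

≅-trans : ∀ {x y z} → x ≅ y → y ≅ z → x ≅ z
≅-trans (n , d) (n′ , d′) = LR.trans n n′ , LR.trans d d′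

+ᴿ-cong : ∀ {x x′ y y′} → x ≅ x′ → y ≅ y′ → (x +ᴿ y) ≅ (x′ +ᴿ y′)
+ᴿ-cong (nx , dx) (ny , dy) = LR.+-cong (LR.*-cong nx dy) (LR.*-cong ny dx) , LR.*-cong dx dy

*ᴿ-cong : ∀ {x x′ y y′} → x ≅ x′ → y ≅ y′ → (x *ᴿ y) ≅ (x′ *ᴿ y′)
*ᴿ-cong (nx , dx) (ny , dy) = LR.*-cong nx ny , LR.*-cong dx dy

*ᴿ-comm : ∀ x y → (x *ᴿ y) ≅ (y *ᴿ x)
*ᴿ-comm x y = LR.*-comm (num x) (num y) , LR.*-comm (den x) (den y)

+ᴿ-comm : ∀ x y → (x +ᴿ y) ≅ (y +ᴿ x)
+ᴿ-comm x y = LR.+-comm (num x *ᴾ den y) (num y *ᴾ den x) , LR.*-comm (den x) (den y)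

+ᴿ-assoc : ∀ x y z → ((x +ᴿ y) +ᴿ z) ≅ (x +ᴿ (y +ᴿ z))
+ᴿ-assoc x y z =
    solve 6 (λ nx dx ny dy nz dz → (nx :* dy :+ ny :* dx) :* dz :+ nz :* (dx :* dy)
                                 := nx :* (dy :* dz) :+ (ny :* dz :+ nz :* dy) :* dx)
          LR.refl (num x) (den x) (num y) (den y) (num z) (den z)
  , LR.*-assoc (den x) (den y) (den z)

+ᴿ-left-comm : ∀ x y z → (x +ᴿ (y +ᴿ z)) ≅ (y +ᴿ (x +ᴿ z))
+ᴿ-left-comm x y z = ≅-trans (≅-sym (+ᴿ-assoc x y z))
  (≅-trans (+ᴿ-cong (+ᴿ-comm x y) (≅-refl {z})) (+ᴿ-assoc y x z))

+ᴿ-identityˡ : ∀ x → (zeroᴿ +ᴿ x) ≅ x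
+ᴿ-identityˡ x = LR.*-identityʳ (num x) , LR.*-identityˡ (den x)

sumᴿ-++ : ∀ xs ys → sumᴿ (xs ++ ys) ≅ (sumᴿ xs +ᴿ sumᴿ ys)
sumᴿ-++ [] ys = ≅-sym (+ᴿ-identityˡ (sumᴿ ys))
sumᴿ-++ (x ∷ xs) ys =
  ≅-trans (+ᴿ-cong (≅-refl {x}) (sumᴿ-++ xs ys)) (≅-sym (+ᴿ-assoc x (sumᴿ xs) (sumᴿ ys)))

sumᴿ-↭ : ∀ {xs ys} → xs ↭ ys → sumᴿ xs ≅ sumᴿ ys
sumᴿ-↭ ↭.refl = ≅-refl
sumᴿ-↭ (↭.prep x p) = +ᴿ-cong (≅-refl {x}) (sumᴿ-↭ p)
sumᴿ-↭ {x ∷ y ∷ _} {_ ∷ _ ∷ ys} (↭.swap x y p) =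
  ≅-trans (+ᴿ-cong (≅-refl {x}) (+ᴿ-cong (≅-refl {y}) (sumᴿ-↭ p))) (+ᴿ-left-comm x y (sumᴿ ys))
sumᴿ-↭ (↭.trans p p′) = ≅-trans (sumᴿ-↭ p) (sumᴿ-↭ p′)

sumᴿ-map-cong : ∀ {A : Set} {f g : A → RatFun} → (∀ a → f a ≅ g a) → ∀ as → sumᴿ (map f as) ≅ sumᴿ (map g as)
sumᴿ-map-cong e [] = ≅-refl
sumᴿ-map-cong e (a ∷ as) = +ᴿ-cong (e a) (sumᴿ-map-cong e as)

prodᴿ-map-cong : ∀ {A : Set} {f g : A → RatFun} → (∀ a → f a ≅ g a) → ∀ as → prodᴿ (map f as) ≅ prodᴿ (map g as)
prodᴿ-map-cong e [] = ≅-refl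
prodᴿ-map-cong e (a ∷ as) = *ᴿ-cong (e a) (prodᴿ-map-cong e as)

σᵉ : Exp → Exp
σᵉ (a , b) = (b , a)

σᴾ : LPoly → LPoly
σᴾ = map (λ m → (proj₁ m , σᵉ (proj₂ m)))

σᴿ : RatFun → RatFun
σᴿ x = σᴾ (num x) / σᴾ (den x)

coeff-σᴾ : ∀ p i j → coeff (σᴾ p) i j ≡ coeff p j i
coeff-σᴾ [] i j = ≡.refl
coeff-σᴾ ((c , (a , b)) ∷ p) i j rewrite coeff-σᴾ p i j | ∧-comm ⌊ b ℤ.≟ i ⌋ ⌊ a ℤ.≟ j ⌋ = ≡.refl

σᴾ-cong : ∀ {p r} → p ≋ r → σᴾ p ≋ σᴾ r
σᴾ-cong {p} {r} ⟨ e ⟩ = ⟨ (λ i j → ≡.trans (coeff-σᴾ p i j) (≡.trans (e j i) (≡.sym (coeff-σᴾ r i j)))) ⟩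

σᴾ-++ : ∀ p r → σᴾ (p ++ r) ≡ σᴾ p ++ σᴾ r
σᴾ-++ p r = LP.map-++ _ p r

σᴾ-*ᴾ : ∀ p r → σᴾ (p *ᴾ r) ≡ σᴾ p *ᴾ σᴾ r
σᴾ-*ᴾ [] r = ≡.refl
σᴾ-*ᴾ ((c , (a , b)) ∷ p) r = ≡.trans (σᴾ-++ (map _ r) (p *ᴾ r))
  (cong₂ _++_ (≡.trans (≡.sym (LP.map-∘ r)) (LP.map-∘ r)) (σᴾ-*ᴾ p r))

σᴿ-+ᴿ : ∀ x y → σᴿ (x +ᴿ y) ≡ σᴿ x +ᴿ σᴿ y
σᴿ-+ᴿ x y rewrite σᴾ-++ (num x *ᴾ den y) (num y *ᴾ den x)
  | σᴾ-*ᴾ (num x) (den y) | σᴾ-*ᴾ (num y) (den x) | σᴾ-*ᴾ (den x) (den y) = ≡.refl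

σᴿ-*ᴿ : ∀ x y → σᴿ (x *ᴿ y) ≡ σᴿ x *ᴿ σᴿ y
σᴿ-*ᴿ x y rewrite σᴾ-*ᴾ (num x) (num y) | σᴾ-*ᴾ (den x) (den y) = ≡.refl

σᴿ-sumᴿ : ∀ xs → σᴿ (sumᴿ xs) ≡ sumᴿ (map σᴿ xs)
σᴿ-sumᴿ [] = ≡.refl
σᴿ-sumᴿ (x ∷ xs) = ≡.trans (σᴿ-+ᴿ x (sumᴿ xs)) (cong (σᴿ x +ᴿ_) (σᴿ-sumᴿ xs))

σᴿ-prodᴿ : ∀ xs → σᴿ (prodᴿ xs) ≡ prodᴿ (map σᴿ xs)
σᴿ-prodᴿ [] = ≡.refl
σᴿ-prodᴿ (x ∷ xs) = ≡.trans (σᴿ-*ᴿ x (prodᴿ xs)) (cong (σᴿ x *ᴿ_) (σᴿ-prodᴿ xs))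

-- Division by 1 - t/q

1-t/q : LPoly
1-t/q = oneMinus ((-ᵉ qᵉ) +ᵉ tᵉ)

qBound : LPoly → ℕ
qBound [] = 0
qBound ((c , (a , b)) ∷ p) = ℤ.∣ a ∣ ℕ.+ qBound p

i≤+∣i∣ : ∀ i → i ℤ.≤ + ℤ.∣ i ∣
i≤+∣i∣ (+ n) = ℤP.≤-refl
i≤+∣i∣ -[1+ n ] = ℤ.-≤+

coeff-beyond-qBound : ∀ p i j → + qBound p ℤ.< i → coeff p i j ≡ + 0
coeff-beyond-qBound [] i j _ = ≡.refl
coeff-beyond-qBound ((c , (a , b)) ∷ p) i j qBound<i with a ℤ.≟ i
... | yes ≡.refl = contradiction qBound<i
      (ℤP.≤⇒≯ (ℤP.≤-trans (i≤+∣i∣ a) (ℤ.+≤+ (ℕP.m≤m+n ℤ.∣ a ∣ (qBound p)))))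
... | no _ = coeff-beyond-qBound p i j (ℤP.≤-<-trans (ℤ.+≤+ (ℕP.m≤n+m (qBound p) ℤ.∣ a ∣)) qBound<i)

exceeds : ∀ i b → Σ ℕ (λ k → + b ℤ.< i + + k)
exceeds (+ m) b = suc b , ℤ.+<+ (ℕP.≤-trans (ℕP.n<1+n b) (ℕP.m≤n+m (suc b) m))
exceeds -[1+ m ] b = suc m ℕ.+ suc b , ≡.subst (+ b ℤ.<_) (≡.sym sum≡) (ℤ.+<+ (ℕP.n<1+n b))
  where
  cancel : ∀ x y → - x + (x + y) ≡ y
  cancel = solve-∀
  sum≡ : -[1+ m ] + + (suc m ℕ.+ suc b) ≡ + suc b
  sum≡ = ≡.trans (cong (_+_ -[1+ m ]) (ℤP.pos-+ (suc m) (suc b))) (cancel (+ suc m) (+ suc b))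

-- If (1 - t/q) p = 0, the coefficients of p are constant along the diagonals i + j = const,
-- hence zero, p having finite support.
1-t/q-cancel : ∀ p → (1-t/q *ᴾ p) ≋ [] → p ≋ []
1-t/q-cancel p ⟨ e ⟩ = ⟨ (λ i j → ≡.trans (diagonal (proj₁ (exceeds i (qBound p))) i j)
                                          (coeff-beyond-qBound p _ _ (proj₂ (exceeds i (qBound p))))) ⟩
  where
  c = coeff p
  step : ∀ i j → c i j ≡ c (i + + 1) (j - + 1)
  step i j = difference-zero (c i j) (c (i + + 1) (j - + 1))
    (≡.trans (cong (λ u → + 1 * u + (- + 1 * c (i + + 1) (j - + 1) + + 0))
                   (≡.sym (cong₂ c (ℤP.+-identityʳ i) (ℤP.+-identityʳ j))))
             (≡.trans (≡.sym (coeff-*ᴾ 1-t/q p i j)) (e i j)))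
    where
    difference-zero : ∀ x y → + 1 * x + (- + 1 * y + + 0) ≡ + 0 → x ≡ y
    difference-zero x y h = ≡.trans (≡.sym (add-back x y)) (≡.trans (cong (_+ y) h) (ℤP.+-identityˡ y))
      where add-back : ∀ x y → + 1 * x + (- + 1 * y + + 0) + y ≡ x
            add-back = solve-∀
  diagonal : ∀ k i j → c i j ≡ c (i + + k) (j - + k)
  diagonal zero i j = ≡.sym (cong₂ c (ℤP.+-identityʳ i) (ℤP.+-identityʳ j))
  diagonal (suc k) i j = ≡.trans (diagonal k i j)
    (≡.trans (step (i + + k) (j - + k)) (cong₂ c (+-suc i k) (-suc j k)))
    where
    +-suc : ∀ i k → i + + k + + 1 ≡ i + + suc k
    +-suc i k = ≡.trans (regroup i (+ k)) (cong (_+_ i) (≡.sym (ℤP.pos-+ 1 k)))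
      where regroup : ∀ i k → i + k + + 1 ≡ i + (+ 1 + k)
            regroup = solve-∀
    -suc : ∀ j k → j - + k - + 1 ≡ j - + suc k
    -suc j k = ≡.trans (regroup j (+ k)) (cong (λ x → j - x) (≡.sym (ℤP.pos-+ 1 k)))
      where regroup : ∀ j k → j - k - + 1 ≡ j - (+ 1 + k)
            regroup = solve-∀

NNPoly : Set
NNPoly = List (ℕ × (ℕ × ℕ))

embed : NNPoly → LPoly
embed = map (λ m → (+ proj₁ m , (+ proj₁ (proj₂ m) , + proj₂ (proj₂ m))))

term : ℤ → ℤ → ℤ → LPoly
term c i j = (c , (i , j)) ∷ []

geometric : ℕ → ℕ → ℕ → ℕ → NNPoly
geometric c a b zero = []
geometric c a b (suc m) = (c , (a , b ℕ.+ m)) ∷ geometric c (suc a) b m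

+[1+n]-1≡+n : ∀ n → + suc n - + 1 ≡ + n
+[1+n]-1≡+n n = ≡.trans (cong (_- + 1) (ℤP.pos-+ 1 n)) (cancel (+ n))
  where cancel : ∀ a → + 1 + a - + 1 ≡ a
        cancel = solve-∀

1-t/q*geometric : ∀ c a b m → (1-t/q *ᴾ embed (geometric c a b m))
                             ≋ (term (+ c) (+ (a ℕ.+ m) - + 1) (+ b) ++ term (- + c) (+ a - + 1) (+ (b ℕ.+ m)))
1-t/q*geometric c a b zero rewrite ℕP.+-identityʳ a | ℕP.+-identityʳ b =
  LR.sym (LR.-‿inverseʳ (term (+ c) (+ a - + 1) (+ b)))
1-t/q*geometric c a b (suc m) = begin
  1-t/q *ᴾ (X₁ ++ rest)
    ≈⟨ LR.distribˡ 1-t/q X₁ rest ⟩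
  1-t/q *ᴾ X₁ ++ 1-t/q *ᴾ rest
    ≈⟨ LR.+-cong (LR.reflexive head≡) (LR.trans (1-t/q*geometric c (suc a) b m) (LR.reflexive tail≡)) ⟩
  (X₁ ++ X₂) ++ (X₃ ++ -ᴾ X₁)
    ≈⟨ solve 3 (λ X₁ X₂ X₃ → (X₁ :+ X₂) :+ (X₃ :+ :- X₁) := X₃ :+ X₂) LR.refl X₁ X₂ X₃ ⟩
  X₃ ++ X₂ ∎
  where
  open ≋-Reasoning
  rest = embed (geometric c (suc a) b m)
  X₁ = term (+ c) (+ a) (+ (b ℕ.+ m))
  X₂ = term (- + c) (+ a - + 1) (+ (b ℕ.+ suc m))
  X₃ = term (+ c) (+ (a ℕ.+ suc m) - + 1) (+ b)
  head≡ : 1-t/q *ᴾ X₁ ≡ X₁ ++ X₂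
  head≡ = cong₂ (λ u v → u ∷ v ∷ []) (cong (λ z → (z , (+ a , + (b ℕ.+ m)))) (ℤP.*-identityˡ (+ c)))
            (cong₂ _,_ (ℤP.-1*i≡-i (+ c)) (cong₂ _,_ (ℤP.+-comm (- + 1) (+ a))
              (≡.trans (≡.sym (ℤP.pos-+ 1 (b ℕ.+ m))) (cong +_ (≡.sym (ℕP.+-suc b m))))))
  tail≡ : term (+ c) (+ (suc a ℕ.+ m) - + 1) (+ b) ++ term (- + c) (+ suc a - + 1) (+ (b ℕ.+ m)) ≡ X₃ ++ -ᴾ X₁
  tail≡ = cong₂ (λ u v → (+ c , (u , + b)) ∷ (- + c , (v , + (b ℕ.+ m))) ∷ [])
                (cong (λ z → + z - + 1) (≡.sym (ℕP.+-suc a m))) (+[1+n]-1≡+n a)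

qᵏ : ℕ → LPoly
qᵏ k = monoᴾ (+ k , + 0)

-t/q : LPoly
-t/q = term (- + 1) (- + 1) (+ 1)

-- (q^k P(q,t) - (t^(k+1)/q) P(t,q)) / (1 - t/q), computed monomialwise: c q^i t^j contributes
-- c (q^(k+i) t^j - q^(j-1) t^(k+i+1)) / (1 - t/q), a geometric sum of k + i + 1 - j terms.
telescope : ℕ → NNPoly → NNPoly
telescope k [] = []
telescope k ((c , (i , j)) ∷ P) = geometric c j j (k ℕ.+ suc i ℕ.∸ j) ++ telescope k P

1-t/q*telescope : ∀ k P → All (λ m → proj₂ (proj₂ m) ℕ.≤ k) P →
  (1-t/q *ᴾ embed (telescope k P)) ≋ (qᵏ k *ᴾ embed P ++ (-t/q *ᴾ σᴾ (qᵏ k)) *ᴾ σᴾ (embed P))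
1-t/q*telescope k [] [] = LR.refl
1-t/q*telescope k ((c , (i , j)) ∷ P) (j≤k ∷ P≤k) = begin
  1-t/q *ᴾ embed (geometric c j j m ++ telescope k P)
    ≈⟨ LR.reflexive (cong (1-t/q *ᴾ_) (LP.map-++ _ (geometric c j j m) (telescope k P))) ⟩
  1-t/q *ᴾ (embed (geometric c j j m) ++ embed (telescope k P))
    ≈⟨ LR.distribˡ 1-t/q (embed (geometric c j j m)) (embed (telescope k P)) ⟩
  1-t/q *ᴾ embed (geometric c j j m) ++ 1-t/q *ᴾ embed (telescope k P)
    ≈⟨ LR.+-cong (LR.trans (1-t/q*geometric c j j m) (LR.reflexive ends≡)) (1-t/q*telescope k P P≤k) ⟩
  (A₁ ++ B₁) ++ (A ++ B)
    ≈⟨ solve 4 (λ A₁ B₁ A B → (A₁ :+ B₁) :+ (A :+ B) := (A₁ :+ A) :+ (B₁ :+ B)) LR.refl A₁ B₁ A B ⟩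
  (A₁ ++ A) ++ (B₁ ++ B)
    ≈⟨ LR.+-cong (LR.sym (LR.distribˡ (qᵏ k) x (embed P))) (LR.sym (LR.distribˡ V (σᴾ x) (σᴾ (embed P)))) ⟩
  qᵏ k *ᴾ embed ((c , (i , j)) ∷ P) ++ V *ᴾ σᴾ (embed ((c , (i , j)) ∷ P)) ∎
  where
  open ≋-Reasoning
  m = k ℕ.+ suc i ℕ.∸ j
  x = term (+ c) (+ i) (+ j)
  V = -t/q *ᴾ σᴾ (qᵏ k)
  A₁ = qᵏ k *ᴾ x
  B₁ = V *ᴾ σᴾ x
  A = qᵏ k *ᴾ embed P
  B = V *ᴾ σᴾ (embed P)
  j+m≡k+1+i : j ℕ.+ m ≡ suc (k ℕ.+ i)
  j+m≡k+1+i = ≡.trans (ℕP.m+[n∸m]≡n (ℕP.≤-trans j≤k (ℕP.m≤m+n k (suc i)))) (ℕP.+-suc k i)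
  ends≡ : term (+ c) (+ (j ℕ.+ m) - + 1) (+ j) ++ term (- + c) (+ j - + 1) (+ (j ℕ.+ m)) ≡ A₁ ++ B₁
  ends≡ = cong₂ (λ u v → u ∷ v ∷ [])
    (cong₂ _,_ (≡.sym (ℤP.*-identityˡ (+ c)))
               (cong (λ z → (z , + j)) (≡.trans (cong (λ z → + z - + 1) j+m≡k+1+i) (+[1+n]-1≡+n (k ℕ.+ i)))))
    (cong₂ _,_ (≡.sym (ℤP.-1*i≡-i (+ c))) (cong₂ _,_ (ℤP.+-comm (+ j) (- + 1)) (cong +_ j+m≡k+1+i)))

1-t/q-cancelˡ : ∀ p r → (1-t/q *ᴾ p) ≋ (1-t/q *ᴾ r) → p ≋ r
1-t/q-cancelˡ p r e = begin
  p                     ≈⟨ solve 2 (λ p r → p := (p :- r) :+ r) LR.refl p r ⟩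
  (p ++ -ᴾ r) ++ r      ≈⟨ LR.+-cong (1-t/q-cancel (p ++ -ᴾ r) difference≋0) (LR.refl {r}) ⟩
  r                     ∎
  where
  open ≋-Reasoning
  difference≋0 : (1-t/q *ᴾ (p ++ -ᴾ r)) ≋ []
  difference≋0 = begin
    1-t/q *ᴾ (p ++ -ᴾ r)                   ≈⟨ solve 3 (λ L p r → L :* (p :- r) := L :* p :- L :* r) LR.refl 1-t/q p r ⟩
    1-t/q *ᴾ p ++ -ᴾ (1-t/q *ᴾ r)          ≈⟨ LR.+-cong e (LR.refl { -ᴾ (1-t/q *ᴾ r)}) ⟩
    1-t/q *ᴾ r ++ -ᴾ (1-t/q *ᴾ r)          ≈⟨ LR.-‿inverseʳ (1-t/q *ᴾ r) ⟩
    []                                      ∎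

-- σ(1 - t/q) = 1 - q/t, and (-t/q)(1 - q/t) = 1 - t/q.
1-t/q≋-t/q*σ[1-t/q] : 1-t/q ≋ (-t/q *ᴾ σᴾ 1-t/q)
1-t/q≋-t/q*σ[1-t/q] = LR.+-comm (term (+ 1) (+ 0) (+ 0)) -t/q

sum-with-swap≋telescope : ∀ k P X Y → All (λ m → proj₂ (proj₂ m) ℕ.≤ k) P →
  (1-t/q *ᴾ X) ≋ (qᵏ k *ᴾ (embed P *ᴾ Y)) →
  (X *ᴾ σᴾ Y ++ σᴾ X *ᴾ Y) ≋ (embed (telescope k P) *ᴾ (Y *ᴾ σᴾ Y))
sum-with-swap≋telescope k P X Y P≤k eX = 1-t/q-cancelˡ _ _ (begin
  1-t/q *ᴾ (X *ᴾ σY ++ σX *ᴾ Y)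
    ≈⟨ solve 5 (λ L X σY σX Y → L :* (X :* σY :+ σX :* Y) := (L :* X) :* σY :+ L :* σX :* Y) LR.refl 1-t/q X σY σX Y ⟩
  (1-t/q *ᴾ X) *ᴾ σY ++ (1-t/q *ᴾ σX) *ᴾ Y
    ≈⟨ LR.+-cong (LR.*-cong eX (LR.refl {σY})) (LR.*-cong (LR.*-cong 1-t/q≋-t/q*σ[1-t/q] (LR.refl {σX})) (LR.refl {Y})) ⟩
  (Q *ᴾ (P′ *ᴾ Y)) *ᴾ σY ++ ((-t/q *ᴾ σᴾ 1-t/q) *ᴾ σX) *ᴾ Y
    ≈⟨ LR.+-cong (LR.refl {(Q *ᴾ (P′ *ᴾ Y)) *ᴾ σY})
                 (LR.*-cong (LR.trans (LR.*-assoc -t/q (σᴾ 1-t/q) σX) (LR.*-cong (LR.refl { -t/q}) σeX)) (LR.refl {Y})) ⟩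
  (Q *ᴾ (P′ *ᴾ Y)) *ᴾ σY ++ (-t/q *ᴾ (σᴾ Q *ᴾ (σᴾ P′ *ᴾ σY))) *ᴾ Y
    ≈⟨ solve 7 (λ Q P Y σY u σQ σP → (Q :* (P :* Y)) :* σY :+ u :* (σQ :* (σP :* σY)) :* Y
                                    := (Q :* P :+ (u :* σQ) :* σP) :* (Y :* σY)) LR.refl Q P′ Y σY -t/q (σᴾ Q) (σᴾ P′) ⟩
  (Q *ᴾ P′ ++ (-t/q *ᴾ σᴾ Q) *ᴾ σᴾ P′) *ᴾ (Y *ᴾ σY)
    ≈⟨ LR.*-cong (LR.sym (1-t/q*telescope k P P≤k)) (LR.refl {Y *ᴾ σY}) ⟩
  (1-t/q *ᴾ embed (telescope k P)) *ᴾ (Y *ᴾ σY)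
    ≈⟨ LR.*-assoc 1-t/q (embed (telescope k P)) (Y *ᴾ σY) ⟩
  1-t/q *ᴾ (embed (telescope k P) *ᴾ (Y *ᴾ σY)) ∎)
  where
  open ≋-Reasoning
  Q = qᵏ k
  P′ = embed P
  σX = σᴾ X
  σY = σᴾ Y
  σeX : (σᴾ 1-t/q *ᴾ σX) ≋ (σᴾ Q *ᴾ (σᴾ P′ *ᴾ σY))
  σeX = LR.trans (LR.reflexive (≡.sym (σᴾ-*ᴾ 1-t/q X)))
        (LR.trans (σᴾ-cong eX) (LR.reflexive (≡.trans (σᴾ-*ᴾ Q (P′ *ᴾ Y)) (cong (σᴾ Q *ᴾ_) (σᴾ-*ᴾ P′ Y)))))

-- Standard Young tableaux and transposition

T-∧⁻ : ∀ {a b} → T (a ∧ b) → T a × T b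
T-∧⁻ = Equivalence.to T-∧

T-∨⁻ : ∀ a {b} → T (a ∨ b) → T a ⊎ T b
T-∨⁻ true h = inj₁ h
T-∨⁻ false h = inj₂ h

T-not⁻ : ∀ {a} → T (not a) → ¬ T a
T-not⁻ {true} () _
T-not⁻ {false} _ ()

cellEq⇒≡ : ∀ a b → T (cellEq a b) → a ≡ b
cellEq⇒≡ (r , c) (r′ , c′) h =
  cong₂ _,_ (ℕP.≡ᵇ⇒≡ r r′ (proj₁ (T-∧⁻ h))) (ℕP.≡ᵇ⇒≡ c c′ (proj₂ (T-∧⁻ h)))

∈ᶜ⇒∈ : ∀ w zs → T (w ∈ᶜ zs) → w ∈ zs
∈ᶜ⇒∈ w zs h = Any.map (cellEq⇒≡ w _) (any⁻ (cellEq w) zs h)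

distinctCells : List Cell → Bool
distinctCells L = all (λ p → not (cellEq (proj₁ p) (proj₂ p))) (pairs L)

supported : List Cell → Cell → Bool
supported L x = ((proj₁ x ≡ᵇ 0) ∨ ((ℕ.pred (proj₁ x) , proj₂ x) ∈ᶜ L))
              ∧ ((proj₂ x ≡ᵇ 0) ∨ ((proj₁ x , ℕ.pred (proj₂ x)) ∈ᶜ L))

ordered : Cell × Cell → Bool
ordered p = not ((proj₁ (proj₁ p) ≡ᵇ proj₁ (proj₂ p)) ∧ (proj₂ (proj₂ p) <ᵇ proj₂ (proj₁ p)))
          ∧ not ((proj₂ (proj₁ p) ≡ᵇ proj₂ (proj₂ p)) ∧ (proj₁ (proj₂ p) <ᵇ proj₁ (proj₁ p)))

isSYT⁻ : ∀ L → T (isSYT L) → T (distinctCells L) × All (T ∘ supported L) L × All (T ∘ ordered) (pairs L)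
isSYT⁻ L syt with T-∧⁻ {distinctCells L} syt
... | distinct , rest with T-∧⁻ {all (supported L) L} rest
...   | supp , ord = distinct , AllP.all⁺ (supported L) L supp , AllP.all⁺ ordered (pairs L) ord

transpose : Cell → Cell
transpose (r , c) = (c , r)

transposeᵀ : List Cell → List Cell
transposeᵀ = map transpose

transposeᵀ-involutive : ∀ L → transposeᵀ (transposeᵀ L) ≡ L
transposeᵀ-involutive L = ≡.trans (≡.sym (LP.map-∘ L)) (LP.map-id L)

all-map : ∀ {A B : Set} (p : B → Bool) (f : A → B) xs → all p (map f xs) ≡ all (p ∘ f) xs
all-map p f xs = cong and (≡.sym (LP.map-∘ xs))

all-cong : ∀ {A : Set} {p q : A → Bool} → (∀ x → p x ≡ q x) → ∀ xs → all p xs ≡ all q xs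
all-cong e xs = cong and (LP.map-cong e xs)

pairs-map : ∀ {A B : Set} (f : A → B) xs → pairs (map f xs) ≡ map (λ p → (f (proj₁ p) , f (proj₂ p))) (pairs xs)
pairs-map f [] = ≡.refl
pairs-map f (x ∷ xs) = ≡.trans (cong₂ _++_ (≡.trans (≡.sym (LP.map-∘ xs)) (LP.map-∘ xs)) (pairs-map f xs))
  (≡.sym (LP.map-++ _ (map (x ,_) xs) (pairs xs)))

cellEq-transpose : ∀ a b → cellEq (transpose a) (transpose b) ≡ cellEq a b
cellEq-transpose (r , c) (r′ , c′) = ∧-comm (c ≡ᵇ c′) (r ≡ᵇ r′)

∈ᶜ-transpose : ∀ x L → (transpose x ∈ᶜ transposeᵀ L) ≡ (x ∈ᶜ L)
∈ᶜ-transpose x L = cong or (≡.trans (≡.sym (LP.map-∘ L)) (LP.map-cong (cellEq-transpose x) L))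

supported-transpose : ∀ L x → supported (transposeᵀ L) (transpose x) ≡ supported L x
supported-transpose L (r , c)
  rewrite ∈ᶜ-transpose (ℕ.pred r , c) L | ∈ᶜ-transpose (r , ℕ.pred c) L =
  ∧-comm ((c ≡ᵇ 0) ∨ ((r , ℕ.pred c) ∈ᶜ L)) ((r ≡ᵇ 0) ∨ ((ℕ.pred r , c) ∈ᶜ L))

ordered-transpose : ∀ a b → ordered (transpose a , transpose b) ≡ ordered (a , b)
ordered-transpose (r , c) (r′ , c′) =
  ∧-comm (not ((c ≡ᵇ c′) ∧ (r′ <ᵇ r))) (not ((r ≡ᵇ r′) ∧ (c′ <ᵇ c)))

isSYT-transpose : ∀ L → isSYT (transposeᵀ L) ≡ isSYT L
isSYT-transpose L rewrite pairs-map transpose L = cong₂ _∧_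
  (≡.trans (all-map _ _ (pairs L)) (all-cong (λ p → cong not (cellEq-transpose (proj₁ p) (proj₂ p))) (pairs L)))
  (cong₂ _∧_ (≡.trans (all-map _ transpose L) (all-cong (supported-transpose L) L))
             (≡.trans (all-map _ _ (pairs L)) (all-cong (λ p → ordered-transpose (proj₁ p) (proj₂ p)) (pairs L))))

concatMap-↭ : ∀ {A B : Set} {g h : A → List B} → (∀ x → g x ↭ h x) → ∀ xs → concatMap g xs ↭ concatMap h xs
concatMap-↭ e [] = ↭-refl
concatMap-↭ e (x ∷ xs) = ++⁺ (e x) (concatMap-↭ e xs)

concatMap-++-↭ : ∀ {A B : Set} (g h : A → List B) ys →
  concatMap g ys ++ concatMap h ys ↭ concatMap (λ y → g y ++ h y) ys
concatMap-++-↭ g h [] = ↭-refl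
concatMap-++-↭ g h (y ∷ ys) = begin
  (g y ++ G) ++ (h y ++ G′) ≡⟨ LP.++-assoc (g y) G (h y ++ G′) ⟩
  g y ++ (G ++ (h y ++ G′)) ↭⟨ ++⁺ˡ (g y) (shifts G (h y)) ⟩
  g y ++ (h y ++ (G ++ G′)) ≡⟨ ≡.sym (LP.++-assoc (g y) (h y) (G ++ G′)) ⟩
  (g y ++ h y) ++ (G ++ G′) ↭⟨ ++⁺ˡ (g y ++ h y) (concatMap-++-↭ g h ys) ⟩
  (g y ++ h y) ++ concatMap (λ y → g y ++ h y) ys ∎
  where
  open PermutationReasoning
  G = concatMap g ys
  G′ = concatMap h ys

concatMap-[] : ∀ {A B : Set} (ys : List A) → concatMap (λ _ → [] {A = B}) ys ≡ []
concatMap-[] [] = ≡.refl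
concatMap-[] (y ∷ ys) = concatMap-[] ys

concatMap-comm : ∀ {A B C : Set} (f : A → B → List C) xs ys →
  concatMap (λ x → concatMap (f x) ys) xs ↭ concatMap (λ y → concatMap (λ x → f x y) xs) ys
concatMap-comm f [] ys = ↭-reflexive (≡.sym (concatMap-[] ys))
concatMap-comm f (x ∷ xs) ys = ↭-trans (++⁺ˡ (concatMap (f x) ys) (concatMap-comm f xs ys))
  (concatMap-++-↭ (f x) (λ y → concatMap (λ x → f x y) xs) ys)

allFillings-transpose : ∀ k b → map transposeᵀ (allFillings k b) ↭ allFillings k b
allFillings-transpose zero b = ↭-refl
allFillings-transpose (suc k) b = begin
  map transposeᵀ (allFillings (suc k) b)
    ≡⟨ ≡.trans (LP.map-concatMap _ _ U) (LP.concatMap-cong (λ r → ≡.trans (LP.map-concatMap _ _ U)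
         (LP.concatMap-cong (λ c → ≡.trans (≡.sym (LP.map-∘ (allFillings k b))) (LP.map-∘ (allFillings k b))) U)) U) ⟩
  concatMap (λ r → concatMap (λ c → map ((c , r) ∷_) (map transposeᵀ (allFillings k b))) U) U
    ↭⟨ concatMap-↭ (λ r → concatMap-↭ (λ c → map⁺ ((c , r) ∷_) (allFillings-transpose k b)) U) U ⟩
  concatMap (λ r → concatMap (λ c → map ((c , r) ∷_) (allFillings k b)) U) U
    ↭⟨ concatMap-comm (λ r c → map ((c , r) ∷_) (allFillings k b)) U U ⟩
  allFillings (suc k) b ∎
  where
  open PermutationReasoning
  U = upTo b

∈ᶜ-∷⁻ : ∀ w v zs → T (w ∈ᶜ (v ∷ zs)) → w ≡ v ⊎ T (w ∈ᶜ zs)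
∈ᶜ-∷⁻ w v zs h with T-∨⁻ (cellEq w v) h
... | inj₁ e = inj₁ (cellEq⇒≡ w v e)
... | inj₂ e = inj₂ e

¬ordered-below : ∀ r c → ¬ T (ordered ((suc r , c) , (r , c)))
¬ordered-below r c h = T-not⁻ (proj₂ (T-∧⁻ h))
  (Equivalence.from T-∧ (ℕP.≡⇒≡ᵇ c c ≡.refl , ℕP.<⇒<ᵇ (ℕP.n<1+n r)))

¬ordered-left : ∀ r c → ¬ T (ordered ((r , suc c) , (r , c)))
¬ordered-left r c h = T-not⁻ (proj₁ (T-∧⁻ h))
  (Equivalence.from T-∧ (ℕP.≡⇒≡ᵇ r r ≡.refl , ℕP.<⇒<ᵇ (ℕP.n<1+n c)))

OrderedAfter : Cell → List Cell → Set
OrderedAfter x zs = All (λ v → T (ordered (x , v))) zs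

below-not-later : ∀ r c zs → OrderedAfter (suc r , c) zs → ¬ T ((r , c) ∈ᶜ zs)
below-not-later r c zs later h = ¬ordered-below r c (All.lookup later (∈ᶜ⇒∈ (r , c) zs h))

left-not-later : ∀ r c zs → OrderedAfter (r , suc c) zs → ¬ T ((r , c) ∈ᶜ zs)
left-not-later r c zs later h = ¬ordered-left r c (All.lookup later (∈ᶜ⇒∈ (r , c) zs h))

first-cell : ∀ x zs → T (supported (x ∷ zs) x) → OrderedAfter x zs → x ≡ (0 , 0)
first-cell (zero , zero) zs sup later = ≡.refl
first-cell (suc r , c) zs sup later with ∈ᶜ-∷⁻ (r , c) (suc r , c) zs (proj₁ (T-∧⁻ sup))
... | inj₁ e = contradiction (≡.sym (cong proj₁ e)) ℕP.1+n≢n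
... | inj₂ h = contradiction h (below-not-later r c zs later)
first-cell (zero , suc c) zs sup later with ∈ᶜ-∷⁻ (0 , c) (0 , suc c) zs (proj₂ (T-∧⁻ sup))
... | inj₁ e = contradiction (≡.sym (cong proj₂ e)) ℕP.1+n≢n
... | inj₂ h = contradiction h (left-not-later 0 c zs later)

second-cell : ∀ x y zs → x ≡ (0 , 0) → T (not (cellEq x y)) → T (supported (x ∷ y ∷ zs) y) → OrderedAfter y zs →
  y ≡ (0 , 1) ⊎ y ≡ (1 , 0)
second-cell _ (zero , zero) zs ≡.refl () sup later
second-cell _ (suc r , c) zs ≡.refl _ sup later with ∈ᶜ-∷⁻ (r , c) (0 , 0) ((suc r , c) ∷ zs) (proj₁ (T-∧⁻ sup))
... | inj₁ ≡.refl = inj₂ ≡.refl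
... | inj₂ h with ∈ᶜ-∷⁻ (r , c) (suc r , c) zs h
...   | inj₁ e = contradiction (≡.sym (cong proj₁ e)) ℕP.1+n≢n
...   | inj₂ h′ = contradiction h′ (below-not-later r c zs later)
second-cell _ (zero , suc c) zs ≡.refl _ sup later with ∈ᶜ-∷⁻ (0 , c) (0 , 0) ((0 , suc c) ∷ zs) (proj₂ (T-∧⁻ sup))
... | inj₁ ≡.refl = inj₁ ≡.refl
... | inj₂ h with ∈ᶜ-∷⁻ (0 , c) (0 , suc c) zs h
...   | inj₁ e = contradiction (≡.sym (cong proj₂ e)) ℕP.1+n≢n
...   | inj₂ h′ = contradiction h′ (left-not-later 0 c zs later)

syt-second-cell : ∀ x y zs → T (isSYT (x ∷ y ∷ zs)) → y ≡ (0 , 1) ⊎ y ≡ (1 , 0)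
syt-second-cell x y zs syt with isSYT⁻ (x ∷ y ∷ zs) syt
... | distinct , supx ∷ supy ∷ _ , ordered-all =
  second-cell x y zs (first-cell x (y ∷ zs) supx x-first) (proj₁ (T-∧⁻ distinct)) supy y-next
  where
  x-first : OrderedAfter x (y ∷ zs)
  x-first = AllP.map⁻ (AllP.++⁻ˡ (map (x ,_) (y ∷ zs)) ordered-all)
  y-next : OrderedAfter y zs
  y-next = AllP.map⁻ (AllP.++⁻ˡ (map (y ,_) zs) (AllP.++⁻ʳ (map (x ,_) (y ∷ zs)) ordered-all))

filterᵇ-map : ∀ {A B : Set} (p : B → Bool) (f : A → B) xs → filterᵇ p (map f xs) ≡ map f (filterᵇ (p ∘ f) xs)
filterᵇ-map p f [] = ≡.refl
filterᵇ-map p f (x ∷ xs) with p (f x)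
... | true  = cong (f x ∷_) (filterᵇ-map p f xs)
... | false = filterᵇ-map p f xs

filterᵇ-cong : ∀ {A : Set} {p q : A → Bool} → (∀ x → p x ≡ q x) → ∀ xs → filterᵇ p xs ≡ filterᵇ q xs
filterᵇ-cong e [] = ≡.refl
filterᵇ-cong {p = p} {q} e (x ∷ xs) rewrite e x with q x
... | true  = cong (x ∷_) (filterᵇ-cong e xs)
... | false = filterᵇ-cong e xs

↭-partition : ∀ {A : Set} (p q : A → Bool) xs → All (λ x → not (p x) ≡ q x) xs →
  xs ↭ filterᵇ p xs ++ filterᵇ q xs
↭-partition p q [] [] = ↭-refl
↭-partition p q (x ∷ xs) (e ∷ es) with p x | q x
... | true  | false = prep x (↭-partition p q xs es)
... | false | true  = ↭-trans (prep x (↭-partition p q xs es)) (↭-sym (shift x (filterᵇ p xs) (filterᵇ q xs)))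

allFillings-length : ∀ k b → All (λ L → length L ≡ k) (allFillings k b)
allFillings-length zero b = ≡.refl ∷ []
allFillings-length (suc k) b =
  AllP.concat⁺ (AllP.map⁺ (All.universal (λ r → AllP.concat⁺ (AllP.map⁺ (All.universal (λ c →
    AllP.map⁺ (All.map (cong suc) (allFillings-length k b))) (upTo b)))) (upTo b)))

SYT-properties : ∀ n → All (λ L → T (isSYT L) × length L ≡ n) (SYT n)
SYT-properties n = All.zip (AllP.all-filter (T? ∘ isSYT) (allFillings n n) , AllP.filter⁺ (T? ∘ isSYT) (allFillings-length n n))

SYT-transpose : ∀ n → map transposeᵀ (SYT n) ↭ SYT n
SYT-transpose n = begin
  map transposeᵀ (filterᵇ isSYT AF)            ≡⟨ cong (map transposeᵀ) (filterᵇ-cong (λ L → ≡.sym (isSYT-transpose L)) AF) ⟩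
  map transposeᵀ (filterᵇ (isSYT ∘ transposeᵀ) AF) ≡⟨ ≡.sym (filterᵇ-map isSYT transposeᵀ AF) ⟩
  filterᵇ isSYT (map transposeᵀ AF)            ↭⟨ filter-↭ (T? ∘ isSYT) (allFillings-transpose n n) ⟩
  filterᵇ isSYT AF                              ∎
  where
  open PermutationReasoning
  AF = allFillings n n

twoAt21 : List Cell → Bool
twoAt21 = twoAt12 ∘ transposeᵀ

not-twoAt12≡twoAt21 : ∀ L → T (isSYT L) → 2 ≤ length L → not (twoAt12 L) ≡ twoAt21 L
not-twoAt12≡twoAt21 [] _ ()
not-twoAt12≡twoAt21 (x ∷ []) _ (s≤s ())
not-twoAt12≡twoAt21 (x ∷ y ∷ zs) syt _ with syt-second-cell x y zs syt
... | inj₁ ≡.refl = ≡.refl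
... | inj₂ ≡.refl = ≡.refl

SYT-split : ∀ n → 2 ≤ n → SYT n ↭ filterᵇ twoAt12 (SYT n) ++ filterᵇ twoAt21 (SYT n)
SYT-split n 2≤n = ↭-partition twoAt12 twoAt21 (SYT n)
  (All.map (λ { {L} (syt , len) → not-twoAt12≡twoAt21 L syt (≡.subst (2 ≤_) (≡.sym len) 2≤n) }) (SYT-properties n))

twoAt21-transpose : ∀ n → filterᵇ twoAt21 (SYT n) ↭ map transposeᵀ (filterᵇ twoAt12 (SYT n))
twoAt21-transpose n = begin
  filterᵇ twoAt21 (SYT n)                         ↭⟨ filter-↭ (T? ∘ twoAt21) (↭-sym (SYT-transpose n)) ⟩
  filterᵇ twoAt21 (map transposeᵀ (SYT n))        ≡⟨ filterᵇ-map twoAt21 transposeᵀ (SYT n) ⟩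
  map transposeᵀ (filterᵇ (twoAt21 ∘ transposeᵀ) (SYT n))
    ≡⟨ cong (map transposeᵀ) (filterᵇ-cong (λ L → cong twoAt12 (transposeᵀ-involutive L)) (SYT n)) ⟩
  map transposeᵀ (filterᵇ twoAt12 (SYT n))        ∎
  where open PermutationReasoning

isZeroExp-σᵉ : ∀ e → isZeroExp (σᵉ e) ≡ isZeroExp e
isZeroExp-σᵉ (+ zero   , + zero)   = ≡.refl
isZeroExp-σᵉ (+ zero   , + suc n)  = ≡.refl
isZeroExp-σᵉ (+ zero   , -[1+ n ]) = ≡.refl
isZeroExp-σᵉ (+ suc m  , + zero)   = ≡.refl
isZeroExp-σᵉ (+ suc m  , + suc n)  = ≡.refl
isZeroExp-σᵉ (+ suc m  , -[1+ n ]) = ≡.refl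
isZeroExp-σᵉ (-[1+ m ] , + zero)   = ≡.refl
isZeroExp-σᵉ (-[1+ m ] , + suc n)  = ≡.refl
isZeroExp-σᵉ (-[1+ m ] , -[1+ n ]) = ≡.refl

oneMinus-σᵉ : ∀ e → oneMinus (σᵉ e) ≡ σᴾ (oneMinus e)
oneMinus-σᵉ e rewrite isZeroExp-σᵉ e with isZeroExp e
... | true  = ≡.refl
... | false = ≡.refl

numF-σᵉ : ∀ e → numF (σᵉ e) ≡ σᴿ (numF e)
numF-σᵉ e = cong (_/ oneᴾ) (oneMinus-σᵉ e)

denF-σᵉ : ∀ e → denF (σᵉ e) ≡ σᴿ (denF e)
denF-σᵉ e = cong (oneᴾ /_) (oneMinus-σᵉ e)

zExps-transpose : ∀ L → map zExp (transposeᵀ L) ≡ map σᵉ (map zExp L)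
zExps-transpose L = ≡.trans (≡.sym (LP.map-∘ L)) (LP.map-∘ L)

exponent : List ℤ → List Exp → Exp
exponent a zs = foldr _+ᵉ_ zeroᵉ (zipWith _·ᵉ_ a zs)

exponent-σᵉ : ∀ a zs → exponent a (map σᵉ zs) ≡ σᵉ (exponent a zs)
exponent-σᵉ [] zs = ≡.refl
exponent-σᵉ (k ∷ a) [] = ≡.refl
exponent-σᵉ (k ∷ a) (z ∷ zs) = cong ((k ·ᵉ σᵉ z) +ᵉ_) (exponent-σᵉ a zs)

zPow-transpose : ∀ a L → zPow a (transposeᵀ L) ≡ σᴿ (zPow a L)
zPow-transpose a L rewrite zExps-transpose L | LP.drop-map {f = σᵉ} 1 (map zExp L) =
  cong (λ e → monoᴾ e / oneᴾ) (exponent-σᵉ a (drop 1 (map zExp L)))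

consecutiveFactor : Exp → Exp → RatFun
consecutiveFactor zprev z = denF (-ᵉ z) *ᴿ denF (qtᵉ +ᵉ (zprev +ᵉ (-ᵉ z)))

pairFactor : Exp × Exp → RatFun
pairFactor p = let d = proj₁ p +ᵉ (-ᵉ proj₂ p) in
  numF d *ᴿ (numF (qtᵉ +ᵉ d) *ᴿ (denF (qᵉ +ᵉ d) *ᴿ denF (tᵉ +ᵉ d)))

consecutiveFactor-σᵉ : ∀ x y → consecutiveFactor (σᵉ x) (σᵉ y) ≡ σᴿ (consecutiveFactor x y)
consecutiveFactor-σᵉ x y = ≡.trans (cong₂ _*ᴿ_ (denF-σᵉ (-ᵉ y)) (denF-σᵉ (qtᵉ +ᵉ (x +ᵉ (-ᵉ y)))))
  (≡.sym (σᴿ-*ᴿ (denF (-ᵉ y)) (denF (qtᵉ +ᵉ (x +ᵉ (-ᵉ y))))))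

-- Exchanging q and t exchanges the factors 1/(1 - q z_i/z_j) and 1/(1 - t z_i/z_j).
pairFactor-σᵉ : ∀ x y → pairFactor (σᵉ x , σᵉ y) ≅ σᴿ (pairFactor (x , y))
pairFactor-σᵉ x y = ≅-trans (≅-reflexive swapped)
  (≅-trans (*ᴿ-cong (≅-refl {σᴿ (numF d)}) (*ᴿ-cong (≅-refl {σᴿ (numF (qtᵉ +ᵉ d))}) (*ᴿ-comm Ct Cq)))
           (≅-reflexive (≡.sym σ-distributed)))
  where
  d = x +ᵉ (-ᵉ y)
  Cq = σᴿ (denF (qᵉ +ᵉ d))
  Ct = σᴿ (denF (tᵉ +ᵉ d))
  swapped : pairFactor (σᵉ x , σᵉ y) ≡ σᴿ (numF d) *ᴿ (σᴿ (numF (qtᵉ +ᵉ d)) *ᴿ (Ct *ᴿ Cq))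
  swapped = cong₂ _*ᴿ_ (numF-σᵉ d)
    (cong₂ _*ᴿ_ (numF-σᵉ (qtᵉ +ᵉ d)) (cong₂ _*ᴿ_ (denF-σᵉ (tᵉ +ᵉ d)) (denF-σᵉ (qᵉ +ᵉ d))))
  σ-distributed : σᴿ (pairFactor (x , y)) ≡ σᴿ (numF d) *ᴿ (σᴿ (numF (qtᵉ +ᵉ d)) *ᴿ (Cq *ᴿ Ct))
  σ-distributed = ≡.trans (σᴿ-*ᴿ (numF d) _) (cong (σᴿ (numF d) *ᴿ_) (≡.trans (σᴿ-*ᴿ (numF (qtᵉ +ᵉ d)) _)
    (cong (σᴿ (numF (qtᵉ +ᵉ d)) *ᴿ_) (σᴿ-*ᴿ (denF (qᵉ +ᵉ d)) (denF (tᵉ +ᵉ d))))))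

zipWith-cong : ∀ {A B C : Set} {f g : A → B → C} → (∀ x y → f x y ≡ g x y) →
  ∀ xs ys → zipWith f xs ys ≡ zipWith g xs ys
zipWith-cong e [] ys = ≡.refl
zipWith-cong e (x ∷ xs) [] = ≡.refl
zipWith-cong e (x ∷ xs) (y ∷ ys) = cong₂ _∷_ (e x y) (zipWith-cong e xs ys)

consecutive-σᵉ : ∀ zs → prodᴿ (zipWith consecutiveFactor (map σᵉ zs) (drop 1 (map σᵉ zs)))
                      ≡ σᴿ (prodᴿ (zipWith consecutiveFactor zs (drop 1 zs)))
consecutive-σᵉ zs = begin
  prodᴿ (zipWith consecutiveFactor (map σᵉ zs) (drop 1 (map σᵉ zs)))
    ≡⟨ cong (λ ys → prodᴿ (zipWith consecutiveFactor (map σᵉ zs) ys)) (LP.drop-map 1 zs) ⟩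
  prodᴿ (zipWith consecutiveFactor (map σᵉ zs) (map σᵉ (drop 1 zs)))
    ≡⟨ cong prodᴿ (LP.zipWith-map consecutiveFactor σᵉ σᵉ zs (drop 1 zs)) ⟩
  prodᴿ (zipWith (λ x y → consecutiveFactor (σᵉ x) (σᵉ y)) zs (drop 1 zs))
    ≡⟨ cong prodᴿ (zipWith-cong consecutiveFactor-σᵉ zs (drop 1 zs)) ⟩
  prodᴿ (zipWith (λ x y → σᴿ (consecutiveFactor x y)) zs (drop 1 zs))
    ≡⟨ cong prodᴿ (≡.sym (LP.map-zipWith consecutiveFactor σᴿ zs (drop 1 zs))) ⟩
  prodᴿ (map σᴿ (zipWith consecutiveFactor zs (drop 1 zs)))
    ≡⟨ ≡.sym (σᴿ-prodᴿ (zipWith consecutiveFactor zs (drop 1 zs))) ⟩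
  σᴿ (prodᴿ (zipWith consecutiveFactor zs (drop 1 zs))) ∎
  where open ≡.≡-Reasoning

pairs-σᵉ : ∀ zs → prodᴿ (map pairFactor (pairs (map σᵉ zs))) ≅ σᴿ (prodᴿ (map pairFactor (pairs zs)))
pairs-σᵉ zs = ≅-trans (≅-reflexive (cong (λ ps → prodᴿ (map pairFactor ps)) (pairs-map σᵉ zs)))
  (≅-trans (≅-reflexive (cong prodᴿ (≡.sym (LP.map-∘ (pairs zs)))))
  (≅-trans (prodᴿ-map-cong (λ p → pairFactor-σᵉ (proj₁ p) (proj₂ p)) (pairs zs))
           (≅-reflexive (≡.trans (cong prodᴿ (LP.map-∘ (pairs zs))) (≡.sym (σᴿ-prodᴿ (map pairFactor (pairs zs))))))))

wt-transpose : ∀ L → wt (transposeᵀ L) ≅ σᴿ (wt L)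
wt-transpose L rewrite zExps-transpose L = wt-σᵉ (map zExp L)
  where
  wt-σᵉ : ∀ zs →
    (prodᴿ (zipWith consecutiveFactor (map σᵉ zs) (drop 1 (map σᵉ zs))) *ᴿ prodᴿ (map pairFactor (pairs (map σᵉ zs))))
    ≅ σᴿ (prodᴿ (zipWith consecutiveFactor zs (drop 1 zs)) *ᴿ prodᴿ (map pairFactor (pairs zs)))
  wt-σᵉ zs = ≅-trans (*ᴿ-cong (≅-reflexive (consecutive-σᵉ zs)) (pairs-σᵉ zs))
    (≅-reflexive (≡.sym (σᴿ-*ᴿ (prodᴿ (zipWith consecutiveFactor zs (drop 1 zs))) (prodᴿ (map pairFactor (pairs zs))))))

-- Comparing F with H

-- y = (c / c′) x, keeping the denominator.
Scaled : LPoly → LPoly → RatFun → RatFun → Set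
Scaled c c′ x y = (den x ≋ den y) × ((c *ᴾ num x) ≋ (c′ *ᴾ num y))

+ᴿ-scaled : ∀ c c′ {x x′ y y′} → Scaled c c′ x y → Scaled c c′ x′ y′ → Scaled c c′ (x +ᴿ x′) (y +ᴿ y′)
+ᴿ-scaled c c′ {x} {x′} {y} {y′} (dx , nx) (dx′ , nx′) = LR.*-cong dx dx′ , (begin
  c *ᴾ (num x *ᴾ den x′ ++ num x′ *ᴾ den x)
    ≈⟨ solve 5 (λ c n d n′ d′ → c :* (n :* d′ :+ n′ :* d) := (c :* n) :* d′ :+ (c :* n′) :* d)
               LR.refl c (num x) (den x) (num x′) (den x′) ⟩
  (c *ᴾ num x) *ᴾ den x′ ++ (c *ᴾ num x′) *ᴾ den x
    ≈⟨ LR.+-cong (LR.*-cong nx dx′) (LR.*-cong nx′ dx) ⟩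
  (c′ *ᴾ num y) *ᴾ den y′ ++ (c′ *ᴾ num y′) *ᴾ den y
    ≈⟨ solve 5 (λ c n d n′ d′ → (c :* n) :* d′ :+ (c :* n′) :* d := c :* (n :* d′ :+ n′ :* d))
               LR.refl c′ (num y) (den y) (num y′) (den y′) ⟩
  c′ *ᴾ (num y *ᴾ den y′ ++ num y′ *ᴾ den y) ∎)
  where open ≋-Reasoning

sumᴿ-scaled : ∀ {A : Set} c c′ (f g : A → RatFun) xs → All (λ x → Scaled c c′ (f x) (g x)) xs →
  Scaled c c′ (sumᴿ (map f xs)) (sumᴿ (map g xs))
sumᴿ-scaled c c′ f g [] [] = LR.refl , LR.trans (LR.zeroʳ c) (LR.sym (LR.zeroʳ c′))
sumᴿ-scaled c c′ f g (x ∷ xs) (s ∷ ss) = +ᴿ-scaled c c′ s (sumᴿ-scaled c c′ f g xs ss)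

hSummand fSummand : List ℤ → List Cell → RatFun
hSummand a L = zPow a L *ᴿ (numF ((-ᵉ qᵉ) +ᵉ tᵉ) *ᴿ wt L)
fSummand a L = zPow a L *ᴿ wt L

zPow-raise-a₂ : ∀ a₂ N as k → N - a₂ ≡ + k → ∀ x rest →
  qᵏ k *ᴾ num (zPow (a₂ ∷ as) (x ∷ (0 , 1) ∷ rest)) ≡ num (zPow (N ∷ as) (x ∷ (0 , 1) ∷ rest))
zPow-raise-a₂ a₂ N as k N-a₂≡k x rest = cong (λ e → (+ 1 , e) ∷ []) (cong₂ _,_
  (≡.trans (cong (_+ (a₂ * + 1 + proj₁ R)) (≡.sym N-a₂≡k)) (shift-q N a₂ (proj₁ R)))
  (shift-t N a₂ (proj₂ R)))
  where
  R = exponent as (map zExp rest)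
  shift-q : ∀ N a₂ r → N - a₂ + (a₂ * + 1 + r) ≡ N * + 1 + r
  shift-q = solve-∀
  shift-t : ∀ N a₂ r → + 0 + (a₂ * + 0 + r) ≡ N * + 0 + r
  shift-t = solve-∀

twoAt12-scaled : ∀ a₂ N as k → N - a₂ ≡ + k → ∀ L → T (twoAt12 L) →
  Scaled (qᵏ k) 1-t/q (hSummand (a₂ ∷ as) L) (fSummand (N ∷ as) L)
twoAt12-scaled a₂ N as k N-a₂≡k (x ∷ y ∷ rest) twoAt12-L with cellEq⇒≡ y (0 , 1) twoAt12-L
... | ≡.refl = LR.*-identityˡ (oneᴾ *ᴾ den (wt L)) , (begin
  qᵏ k *ᴾ (zₐ *ᴾ (1-t/q *ᴾ w))
    ≈⟨ solve 4 (λ Q Z L W → Q :* (Z :* (L :* W)) := L :* ((Q :* Z) :* W)) LR.refl (qᵏ k) zₐ 1-t/q w ⟩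
  1-t/q *ᴾ ((qᵏ k *ᴾ zₐ) *ᴾ w)
    ≈⟨ LR.reflexive (cong (λ z → 1-t/q *ᴾ (z *ᴾ w)) (zPow-raise-a₂ a₂ N as k N-a₂≡k x rest)) ⟩
  1-t/q *ᴾ (num (zPow (N ∷ as) L) *ᴾ w) ∎)
  where
  open ≋-Reasoning
  L = x ∷ (0 , 1) ∷ rest
  zₐ = num (zPow (a₂ ∷ as) L)
  w = num (wt L)

fSummand-transpose : ∀ a L → fSummand a (transposeᵀ L) ≅ σᴿ (fSummand a L)
fSummand-transpose a L = ≅-trans (*ᴿ-cong (≅-reflexive (zPow-transpose a L)) (wt-transpose L))
                                 (≅-reflexive (≡.sym (σᴿ-*ᴿ (zPow a L) (wt L))))

F₁₂ : ℕ → List ℤ → RatFun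
F₁₂ n a = sumᴿ (map (fSummand a) (filterᵇ twoAt12 (SYT n)))

F≅F₁₂+σF₁₂ : ∀ n (a : Vec ℤ (n ∸ 1)) → 2 ≤ n → F n a ≅ (F₁₂ n (toList a) +ᴿ σᴿ (F₁₂ n (toList a)))
F≅F₁₂+σF₁₂ n a 2≤n = ≅-trans (sumᴿ-↭ (map⁺ f (SYT-split n 2≤n)))
  (≅-trans (≅-reflexive (cong sumᴿ (LP.map-++ f A B)))
  (≅-trans (sumᴿ-++ (map f A) (map f B)) (+ᴿ-cong (≅-refl {F₁₂ n (toList a)}) B-part)))
  where
  f = fSummand (toList a)
  A = filterᵇ twoAt12 (SYT n)
  B = filterᵇ twoAt21 (SYT n)
  B-part : sumᴿ (map f B) ≅ σᴿ (F₁₂ n (toList a))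
  B-part = ≅-trans (sumᴿ-↭ (map⁺ f (twoAt21-transpose n)))
    (≅-trans (≅-reflexive (cong sumᴿ (≡.sym (LP.map-∘ A))))
    (≅-trans (sumᴿ-map-cong (fSummand-transpose (toList a)) A)
             (≅-reflexive (≡.trans (cong sumᴿ (LP.map-∘ A)) (≡.sym (σᴿ-sumᴿ (map f A)))))))

tDegree : NNPoly → ℕ
tDegree = foldr (λ m d → proj₂ (proj₂ m) ⊔ d) 0

tDegree-bound : ∀ P k → tDegree P ≤ k → All (λ m → proj₂ (proj₂ m) ≤ k) P
tDegree-bound [] k _ = []
tDegree-bound ((c , (i , j)) ∷ P) k d≤k =
  ℕP.≤-trans (ℕP.m≤m⊔n j (tDegree P)) d≤k ∷ tDegree-bound P k (ℕP.≤-trans (ℕP.m≤n⊔m j (tDegree P)) d≤k)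

a+d≤N⇒d≤N-a : ∀ N a d → a + d ℤ.≤ N → d ℤ.≤ N - a
a+d≤N⇒d≤N-a N a d a+d≤N = ≡.subst₂ ℤ._≤_ (cancel a d) (ℤP.+-comm (- a) N) (ℤP.+-monoʳ-≤ (- a) a+d≤N)
  where cancel : ∀ a d → - a + (a + d) ≡ d
        cancel = solve-∀

excess : ∀ N a₂ d → a₂ + + d ℤ.≤ N → Σ ℕ (λ k → N - a₂ ≡ + k × d ≤ k)
excess N a₂ d N₀≤N with N - a₂ | a+d≤N⇒d≤N-a N a₂ (+ d) N₀≤N
... | + k | +≤+ d≤k = k , ≡.refl , d≤k

F-telescopes : ∀ m (a₂ N : ℤ) (as : Vec ℤ m) k P → N - a₂ ≡ + k → tDegree P ≤ k →
  H (suc (suc m)) (a₂ ∷ᵛ as) ≈ᴿ (embed P / oneᴾ) →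
  F (suc (suc m)) (N ∷ᵛ as) ≈ᴿ (embed (telescope k P) / oneᴾ)
F-telescopes m a₂ N as k P N-a₂≡k d≤k H≈P = get (begin
  num (F n (N ∷ᵛ as)) *ᴾ oneᴾ        ≈⟨ LR.*-identityʳ _ ⟩
  num (F n (N ∷ᵛ as))                ≈⟨ proj₁ F≅ ⟩
  X *ᴾ σᴾ Y ++ σᴾ X *ᴾ Y             ≈⟨ sum-with-swap≋telescope k P X Y (tDegree-bound P k d≤k) 1-t/q*X≋qᵏPY ⟩
  embed (telescope k P) *ᴾ (Y *ᴾ σᴾ Y) ≈⟨ LR.*-cong (LR.refl {embed (telescope k P)}) (LR.sym (proj₂ F≅)) ⟩
  embed (telescope k P) *ᴾ den (F n (N ∷ᵛ as)) ∎)
  where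
  open ≋-Reasoning
  n = suc (suc m)
  X = num (F₁₂ n (N ∷ toList as))
  Y = den (F₁₂ n (N ∷ toList as))
  F≅ = F≅F₁₂+σF₁₂ n (N ∷ᵛ as) (s≤s (s≤s z≤n))
  H-scaled : Scaled (qᵏ k) 1-t/q (H n (a₂ ∷ᵛ as)) (F₁₂ n (N ∷ toList as))
  H-scaled = sumᴿ-scaled (qᵏ k) 1-t/q (hSummand (a₂ ∷ toList as)) (fSummand (N ∷ toList as))
    (filterᵇ twoAt12 (SYT n))
    (All.map (λ {L} → twoAt12-scaled a₂ N (toList as) k N-a₂≡k L) (AllP.all-filter (T? ∘ twoAt12) (SYT n)))
  1-t/q*X≋qᵏPY : (1-t/q *ᴾ X) ≋ (qᵏ k *ᴾ (embed P *ᴾ Y))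
  1-t/q*X≋qᵏPY = begin
    1-t/q *ᴾ X
      ≈⟨ LR.sym (proj₂ H-scaled) ⟩
    qᵏ k *ᴾ num (H n (a₂ ∷ᵛ as))
      ≈⟨ LR.*-cong (LR.refl {qᵏ k}) (LR.trans (LR.sym (LR.*-identityʳ _)) ⟨ H≈P ⟩) ⟩
    qᵏ k *ᴾ (embed P *ᴾ den (H n (a₂ ∷ᵛ as)))
      ≈⟨ LR.*-cong (LR.refl {qᵏ k}) (LR.*-cong (LR.refl {embed P}) (proj₁ H-scaled)) ⟩
    qᵏ k *ᴾ (embed P *ᴾ Y) ∎

corollary2p17 : (n : ℕ) → 3 ≤ n → (a : Vec ℤ (n ∸ 1)) →
    IsNNPoly (H n a) →
    Σ ℤ (λ N₀ → (N : ℤ) → N₀ ℤ.≤ N → IsNNPoly (F n (setFirst N a)))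
corollary2p17 (suc (suc (suc m))) (s≤s (s≤s (s≤s _))) (a₂ ∷ᵛ as) (P , H≈P) = a₂ + + tDegree P , F-nonneg
  where
  F-nonneg : ∀ N → a₂ + + tDegree P ℤ.≤ N → IsNNPoly (F (3 ℕ.+ m) (N ∷ᵛ as))
  F-nonneg N N₀≤N with excess N a₂ (tDegree P) N₀≤N
  ... | k , N-a₂≡k , d≤k = telescope k P , F-telescopes (suc m) a₂ N as k P N-a₂≡k d≤k H≈P
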